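{- Let $k$ be a positive integer, $a=3k+2$, $b=2a-3$, $c=2a-1$, $S=\{a,b,c\}$ and $G=\langle S\rangle$. For $i\in[0,2k+1]$ let $I_{i,k}=\{ia-3\lfloor i/2\rfloor\}\cup[ia-3\lfloor i/2\rfloor+2,\,ia]$ (where $[u,v]=\emptyset$ if $u>v$), and let $H_{9,k}=\bigcup_{i=0}^{2k+1}I_{i,k}\cup[2ka+4,\infty[$. Then: (1) $x\in G$ if and only if $x=(s+2q)a-3q+2r$ for some $q,r,s\in\mathbb{N}$ with $0\le r\le q$; (2) $G=H_{9,k}$; (3) $H_{9,k}$ is a $3$-permutation numerical semigroup.
   Context: For $u\le v$ in $\mathbb{N}$, $[u,v]=\{x\in\mathbb{N}: u\le x\le v\}$ and $[u,\infty[\,=\{x\in\mathbb{N}:x\ge u\}$. A numerical semigroup is a submonoid $G$ of $(\mathbb{N},+,0)$ with $\mathbb{N}\setminus G$ finite; $\langle S\rangle$ is the submonoid generated by $S$. Write the elements of $G$ as $0=g_0<g_1<g_2<\cdots$. For $n\ge 1$, $G$ is an $n$-permutation numerical semigroup if $G=\langle g_1,\dots,g_n\rangle$ and for every integer $k\ge 0$ the tuple $(g_{kn+1}\bmod n,\dots,g_{kn+n}\bmod n)$ contains exactly one representative of each residue class of $\mathbb{Z}/n\mathbb{Z}$. -}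

module Defs where

open import Data.Nat using (ℕ; zero; suc; _+_; _*_; _∸_; _≤_; _<_; NonZero)
open import Data.Nat.DivMod using (_/_; _%_)
open import Data.Fin using (Fin; toℕ)
open import Data.Product using (Σ; ∃; ∃-syntax; _×_; _,_)
open import Data.Sum using (_⊎_)
open import Relation.Binary.PropositionalEquality using (_≡_)
open import Function.Bundles using (_⇔_)

ΣFin : (n : ℕ) → (Fin n → ℕ) → ℕ
ΣFin zero    f = 0
ΣFin (suc n) f = f Fin.zero + ΣFin n (λ i → f (Fin.suc i))

InGen : (n : ℕ) → (Fin n → ℕ) → ℕ → Set
InGen n h x = Σ (Fin n → ℕ) λ c → x ≡ ΣFin n (λ i → c i * h i)

InGen3 : ℕ → ℕ → ℕ → ℕ → Set
InGen3 a b c x = ∃[ p ] ∃[ q ] ∃[ r ] (x ≡ p * a + q * b + r * c)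

record IsNumericalSemigroup (P : ℕ → Set) : Set where
  field
    has0     : P 0
    closed+  : ∀ x y → P x → P y → P (x + y)
    cofinite : ∃[ F ] (∀ x → F ≤ x → P x)

IsEnumeration : (P : ℕ → Set) → (ℕ → ℕ) → Set
IsEnumeration P g =
  (∀ j → g j < g (suc j)) × (∀ j → P (g j)) × (∀ x → P x → ∃[ j ] (g j ≡ x))

record IsPermNS (n : ℕ) .{{_ : NonZero n}} (P : ℕ → Set) : Set where
  field
    numSG     : IsNumericalSemigroup P
    g         : ℕ → ℕ
    enum      : IsEnumeration P g
    generated : ∀ x → P x ⇔ InGen n (λ i → g (suc (toℕ i))) x
    residues  : ∀ k (r : Fin n) →
                Σ (Fin n) λ i → (g (k * n + suc (toℕ i)) % n ≡ toℕ r)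
                  × (∀ j → g (k * n + suc (toℕ j)) % n ≡ toℕ r → j ≡ i)

aK : ℕ → ℕ
aK k = 3 * k + 2

bK : ℕ → ℕ
bK k = 2 * aK k ∸ 3

cK : ℕ → ℕ
cK k = 2 * aK k ∸ 1

InI : ℕ → ℕ → ℕ → Set
InI i k x = (x ≡ i * aK k ∸ 3 * (i / 2))
          ⊎ ((i * aK k ∸ 3 * (i / 2) + 2 ≤ x) × (x ≤ i * aK k))

InH9 : ℕ → ℕ → Set
InH9 k x = (∃[ i ] (i ≤ 2 * k + 1 × InI i k x)) ⊎ (2 * k * aK k + 4 ≤ x)

{-# OPTIONS --safe #-}
-- Since c = b + 2 and b + 3 = 2a, the elements of ⟨a, b, c⟩ are the numbers
-- s a + q b + 2 r = (s + 2q) a − 3q + 2r with r ≤ q. For fixed j = s + 2q and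
-- h = ⌊j/2⌋, the offsets 3(h − q) + 2r from L j = j a − 3h range exactly over
-- {0} ∪ [2, 3h], so these elements form the zone {L j} ∪ [L j + 2, j a] = I_{j,k}.
-- From j = 2k + 1 on, consecutive zones overlap and fill [2ka + 4, ∞[.
-- Listing the elements increasingly, each block g_{3m+1}, g_{3m+2}, g_{3m+3} is
-- either three consecutive integers or i a, L (i + 1), L (i + 1) + 2 with
-- L (i + 1) ≡ i a + 2 (mod 3); either way it meets every residue class mod 3 once.
module Submission where

open import Defs
open import Data.Nat using (ℕ; zero; suc; _+_; _*_; _∸_; _≤_; _<_; _≤′_; ≤′-refl; ≤′-step; z≤n; s≤s; _≤?_; _≟_; NonZero)
open import Data.Nat.Properties
open import Data.Nat.DivMod
open import Data.List using (_∷_; [])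
open import Data.Nat.Tactic.RingSolver using (solve)
open import Data.Nat.Divisibility using (_∣_; _∤_; ∣m+n∣m⇒∣n; n∣m*n; m∣m*n; divides-refl; _∣?_)
open import Data.Fin using (Fin; zero; suc; toℕ; punchOut)
open import Data.Fin.Properties using (any?; pigeonhole; punchOut-injective; toℕ-fromℕ<)
  renaming (_≟_ to _≟ᶠ_; <⇒≢ to <⇒≢ᶠ)
open import Data.Product using (Σ; ∃-syntax; _×_; _,_; proj₁)
open import Data.Sum using (_⊎_; inj₁; inj₂)
open import Relation.Binary using (tri<; tri≈; tri>)
open import Algebra.Properties.CommutativeSemigroup +-commutativeSemigroup using (xy∙z≈xz∙y)
open import Function.Base using (case_of_)
open import Function.Bundles using (_⇔_; mk⇔; Equivalence)
import Function.Properties.Equivalence as ⇔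
open import Function.Definitions using (Injective)
open import Relation.Nullary using (Dec; yes; no; ¬_; contradiction)
open import Relation.Nullary.Decidable using (_⊎-dec_; _×-dec_; from-no; map′)
open import Relation.Unary using (Decidable)
open import Relation.Binary.PropositionalEquality

module Enumeration {P : ℕ → Set} (P? : Decidable P) (F : ℕ) (P[F+_] : ∀ x → P (F + x)) where

  private
    leastFrom : ℕ → ℕ → ℕ
    leastFrom zero    y = y
    leastFrom (suc f) y with P? y
    ... | yes _ = y
    ... | no  _ = leastFrom f (suc y)

    leastFrom-≥ : ∀ f y → y ≤ leastFrom f y
    leastFrom-≥ zero    y = ≤-refl
    leastFrom-≥ (suc f) y with P? y
    ... | yes _ = ≤-refl
    ... | no  _ = ≤-trans (n≤1+n y) (leastFrom-≥ f (suc y))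

    leastFrom-∈ : ∀ f y → P (f + y) → P (leastFrom f y)
    leastFrom-∈ zero    y p = p
    leastFrom-∈ (suc f) y p with P? y
    ... | yes py = py
    ... | no  _  = leastFrom-∈ f (suc y) (subst P (sym (+-suc f y)) p)

    leastFrom-minimal : ∀ f y z → y ≤ z → z < leastFrom f y → ¬ P z
    leastFrom-minimal zero    y z y≤z z<y = contradiction y≤z (<⇒≱ z<y)
    leastFrom-minimal (suc f) y z y≤z z<l with P? y
    ... | yes _  = contradiction y≤z (<⇒≱ z<l)
    ... | no ¬py with m≤n⇒m<n∨m≡n y≤z
    ...   | inj₂ refl = ¬py
    ...   | inj₁ y<z  = leastFrom-minimal f (suc y) z y<z z<l

  -- opaque: letting the type checker unfold the search is prohibitively expensive
  opaque
    next : ℕ → ℕ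
    next x = leastFrom F (suc x)

    x<next : ∀ x → x < next x
    x<next x = leastFrom-≥ F (suc x)

    next-∈ : ∀ x → P (next x)
    next-∈ x = leastFrom-∈ F (suc x) P[F+ suc x ]

    next-gap : ∀ x z → x < z → z < next x → ¬ P z
    next-gap x = leastFrom-minimal F (suc x)

  next≡ : ∀ x y → x < y → P y → (∀ z → x < z → z < y → ¬ P z) → next x ≡ y
  next≡ x y x<y py gap with <-cmp (next x) y
  ... | tri< n<y _ _ = contradiction (next-∈ x) (gap (next x) (x<next x) n<y)
  ... | tri≈ _ n≡y _ = n≡y
  ... | tri> _ _ y<n = contradiction py (next-gap x y x<y y<n)

  next≡suc : ∀ x → P (suc x) → next x ≡ suc x
  next≡suc x p = next≡ x (suc x) ≤-refl p λ z x<z z<1+x → contradiction z<1+x (<⇒≱ (s≤s x<z))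

  enumerate : ℕ → ℕ
  enumerate zero    = 0
  enumerate (suc j) = next (enumerate j)

  j≤enumerate : ∀ j → j ≤ enumerate j
  j≤enumerate zero    = z≤n
  j≤enumerate (suc j) = ≤-trans (s≤s (j≤enumerate j)) (x<next (enumerate j))

  enumerate-covers : ∀ j x → P x → x ≤ enumerate j → ∃[ i ] (enumerate i ≡ x)
  enumerate-covers zero    x _  x≤0 = 0 , sym (n≤0⇒n≡0 x≤0)
  enumerate-covers (suc j) x px x≤ with x ≤? enumerate j
  ... | yes x≤gj = enumerate-covers j x px x≤gj
  ... | no  x≰gj with m≤n⇒m<n∨m≡n x≤
  ...   | inj₂ x≡ = suc j , sym x≡
  ...   | inj₁ x< = contradiction px (next-gap (enumerate j) x (≰⇒> x≰gj) x<)

  enumerate-isEnumeration : P 0 → IsEnumeration P enumerate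
  enumerate-isEnumeration p0 = (λ j → x<next (enumerate j)) , ∈ , λ x px → enumerate-covers x x px (j≤enumerate x)
    where
    ∈ : ∀ j → P (enumerate j)
    ∈ zero    = p0
    ∈ (suc j) = next-∈ (enumerate j)

injective⇒surjective : ∀ {n} (f : Fin n → Fin n) → Injective _≡_ _≡_ f → ∀ r → ∃[ i ] (f i ≡ r)
injective⇒surjective {suc n} f f-inj r with any? (λ i → f i ≟ᶠ r)
... | yes hit = hit
... | no miss =
  let i , j , i<j , eq = pigeonhole (n<1+n n) (λ i → punchOut (r≢f i))
  in  contradiction (f-inj (punchOut-injective (r≢f i) (r≢f j) eq)) (<⇒≢ᶠ i<j)
  where
  r≢f : ∀ i → r ≢ f i
  r≢f i r≡fi = miss (i , sym r≡fi)

residues-each-once : ∀ {n} .{{_ : NonZero n}} (v : Fin n → ℕ) → (∀ i j → v i % n ≡ v j % n → i ≡ j) →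
  ∀ r → Σ (Fin n) λ i → (v i % n ≡ toℕ r) × (∀ j → v j % n ≡ toℕ r → j ≡ i)
residues-each-once {n} v v-inj r =
  let i , vi≡r = injective⇒surjective (λ i → v i mod n) mod-injective r
      vi%n≡r   = trans (sym (toℕ-fromℕ< _)) (cong toℕ vi≡r)
  in  i , vi%n≡r , λ j vj%n≡r → v-inj j i (trans vj%n≡r (sym vi%n≡r))
  where
  mod-injective : Injective _≡_ _≡_ (λ i → v i mod n)
  mod-injective {i} {j} eq = v-inj i j (trans (sym (toℕ-fromℕ< _)) (trans (cong toℕ eq) (toℕ-fromℕ< _)))

[m+o]%n≡m%n⇒n∣o : ∀ m o n .{{_ : NonZero n}} → (m + o) % n ≡ m % n → n ∣ o
[m+o]%n≡m%n⇒n∣o m o n eq = ∣m+n∣m⇒∣n (subst (n ∣_) [m+o]/n*n≡m/n*n+o (n∣m*n ((m + o) / n))) (n∣m*n (m / n))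
  where
  open ≡-Reasoning
  [m+o]/n*n≡m/n*n+o : (m + o) / n * n ≡ m / n * n + o
  [m+o]/n*n≡m/n*n+o = +-cancelˡ-≡ (m % n) _ _ (begin
    m % n + (m + o) / n * n         ≡⟨ cong (_+ (m + o) / n * n) eq ⟨
    (m + o) % n + (m + o) / n * n   ≡⟨ m≡m%n+[m/n]*n (m + o) n ⟨
    m + o                           ≡⟨ cong (_+ o) (m≡m%n+[m/n]*n m n) ⟩
    m % n + m / n * n + o           ≡⟨ +-assoc (m % n) _ o ⟩
    m % n + (m / n * n + o)         ∎)

ResiduesDistinct : ℕ → ℕ → ℕ → Set
ResiduesDistinct x y z = x % 3 ≢ y % 3 × x % 3 ≢ z % 3 × y % 3 ≢ z % 3

residuesDistinct : ∀ x u w → 3 ∤ u → 3 ∤ w → 3 ∤ w + u → ResiduesDistinct x (u + x) (w + (u + x))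
residuesDistinct x u w 3∤u 3∤w 3∤w+u =
    (λ eq → 3∤u (shift x u eq))
  , (λ eq → 3∤w+u (shift x (w + u) (trans eq (cong (_% 3) (sym (+-assoc w u x))))))
  , (λ eq → 3∤w (shift (u + x) w eq))
  where
  shift : ∀ y o → y % 3 ≡ (o + y) % 3 → 3 ∣ o
  shift y o eq = [m+o]%n≡m%n⇒n∣o y o 3 (trans (cong (_% 3) (+-comm y o)) (sym eq))

3∤c+3d : ∀ c d → 3 ∤ c → 3 ∤ c + 3 * d
3∤c+3d c d 3∤c 3∣c+3d = 3∤c (∣m+n∣m⇒∣n (subst (3 ∣_) (+-comm c (3 * d)) 3∣c+3d) (m∣m*n d))

ResiduesDistinct⇒injective : ∀ (v : Fin 3 → ℕ) → ResiduesDistinct (v zero) (v (suc zero)) (v (suc (suc zero))) →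
                             ∀ i j → v i % 3 ≡ v j % 3 → i ≡ j
ResiduesDistinct⇒injective v (d₀₁ , d₀₂ , d₁₂) = λ where
  zero             zero             _  → refl
  zero             (suc zero)       eq → contradiction eq d₀₁
  zero             (suc (suc zero)) eq → contradiction eq d₀₂
  (suc zero)       zero             eq → contradiction (sym eq) d₀₁
  (suc zero)       (suc zero)       _  → refl
  (suc zero)       (suc (suc zero)) eq → contradiction eq d₁₂
  (suc (suc zero)) zero             eq → contradiction (sym eq) d₀₂
  (suc (suc zero)) (suc zero)       eq → contradiction (sym eq) d₁₂
  (suc (suc zero)) (suc (suc zero)) _  → refl

[2+n]/2≡1+n/2 : ∀ n → (2 + n) / 2 ≡ suc (n / 2)
[2+n]/2≡1+n/2 n = +-distrib-/-∣ˡ n {2} (divides-refl 1)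

2*[n/2]≤n : ∀ n → 2 * (n / 2) ≤ n
2*[n/2]≤n n = subst (_≤ n) (*-comm (n / 2) 2) (m/n*n≤m n 2)

2*m/2≡m : ∀ m → 2 * m / 2 ≡ m
2*m/2≡m m = trans (cong (_/ 2) (*-comm 2 m)) (m*n/n≡m m 2)

2*m≤n⇒m≤n/2 : ∀ m n → 2 * m ≤ n → m ≤ n / 2
2*m≤n⇒m≤n/2 m n 2m≤n = subst (_≤ n / 2) (2*m/2≡m m) (/-monoˡ-≤ 2 2m≤n)

n≤2*m+1⇒n/2≤m : ∀ m n → n ≤ 2 * m + 1 → n / 2 ≤ m
n≤2*m+1⇒n/2≤m m n n≤ = ≤-pred (m<n*o⇒m/o<n (≤-trans (s≤s n≤) (≤-reflexive 2m+2≡[1+m]*2)))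
  where
  2m+2≡[1+m]*2 : suc (2 * m + 1) ≡ suc m * 2
  2m+2≡[1+m]*2 = cong suc (trans (+-comm (2 * m) 1) (cong suc (*-comm 2 m)))

m+2≤3h⇒m+2r≡3q : ∀ m h → m + 2 ≤ 3 * h → ∃[ q ] ∃[ r ] (r ≤ q × q ≤ h × m + 2 * r ≡ 3 * q)
m+2≤3h⇒m+2r≡3q 0                   h             _ = 0 , 0 , z≤n , z≤n , refl
m+2≤3h⇒m+2r≡3q 1                   (suc h)       _ = 1 , 1 , ≤-refl , s≤s z≤n , refl
m+2≤3h⇒m+2r≡3q 2                   (suc (suc h)) _ = 2 , 2 , ≤-refl , s≤s (s≤s z≤n) , refl
m+2≤3h⇒m+2r≡3q 2                   (suc zero)    (s≤s (s≤s (s≤s ())))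
m+2≤3h⇒m+2r≡3q (suc (suc (suc m))) (suc h)       m+5≤3+3h
  with q , r , r≤q , q≤h , m+2r≡3q ←
         m+2≤3h⇒m+2r≡3q m h (+-cancelˡ-≤ 3 _ _ (subst (3 + (m + 2) ≤_) (*-suc 3 h) m+5≤3+3h))
  = suc q , r , m≤n⇒m≤1+n r≤q , s≤s q≤h , trans (cong (3 +_) m+2r≡3q) (sym (*-suc 3 q))

NormalForm : ℕ → ℕ → ℕ → Set
NormalForm a b x = ∃[ q ] ∃[ r ] ∃[ s ] (r ≤ q × x ≡ s * a + q * b + 2 * r)

InGen3⇔NormalForm : ∀ a b x → InGen3 a b (b + 2) x ⇔ NormalForm a b x
InGen3⇔NormalForm a b x = mk⇔
  (λ (p , q , r , x≡) → q + r , r , p , m≤n+m r q , trans x≡ (regroup p q r))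
  (λ (q , r , s , r≤q , x≡) → s , q ∸ r , r , (begin
    x                                  ≡⟨ x≡ ⟩
    s * a + q * b + 2 * r              ≡⟨ cong (λ t → s * a + t * b + 2 * r) (m∸n+n≡m r≤q) ⟨
    s * a + (q ∸ r + r) * b + 2 * r    ≡⟨ regroup s (q ∸ r) r ⟨
    s * a + (q ∸ r) * b + r * (b + 2)  ∎))
  where
  open ≡-Reasoning
  regroup : ∀ p q r → p * a + q * b + r * (b + 2) ≡ p * a + (q + r) * b + 2 * r
  regroup p q r = solve (p ∷ q ∷ r ∷ a ∷ b ∷ [])

NormalForm-+ : ∀ {a b x y} → NormalForm a b x → NormalForm a b y → NormalForm a b (x + y)
NormalForm-+ {a} {b} {x} {y} (q₁ , r₁ , s₁ , r₁≤q₁ , x≡) (q₂ , r₂ , s₂ , r₂≤q₂ , y≡) =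
  q₁ + q₂ , r₁ + r₂ , s₁ + s₂ , +-mono-≤ r₁≤q₁ r₂≤q₂ , (begin
    x + y                                                ≡⟨ cong₂ _+_ x≡ y≡ ⟩
    s₁ * a + q₁ * b + 2 * r₁ + (s₂ * a + q₂ * b + 2 * r₂) ≡⟨ solve (s₁ ∷ q₁ ∷ r₁ ∷ s₂ ∷ q₂ ∷ r₂ ∷ a ∷ b ∷ []) ⟩
    (s₁ + s₂) * a + (q₁ + q₂) * b + 2 * (r₁ + r₂)         ∎)
  where open ≡-Reasoning

InGen⇔InGen3 : ∀ (h : Fin 3 → ℕ) x → InGen 3 h x ⇔ InGen3 (h zero) (h (suc zero)) (h (suc (suc zero))) x
InGen⇔InGen3 h x = mk⇔
  (λ (c , x≡) → c zero , c (suc zero) , c (suc (suc zero)) ,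
                 trans x≡ (sum₃ (c zero) (c (suc zero)) (c (suc (suc zero))) _ _ _))
  (λ (p , q , r , x≡) → coefficients p q r , trans x≡ (sym (sum₃ p q r _ _ _)))
  where
  coefficients : ℕ → ℕ → ℕ → Fin 3 → ℕ
  coefficients p q r zero             = p
  coefficients p q r (suc zero)       = q
  coefficients p q r (suc (suc zero)) = r
  sum₃ : ∀ p q r u v w → p * u + (q * v + (r * w + 0)) ≡ p * u + q * v + r * w
  sum₃ p q r u v w = solve (p ∷ q ∷ r ∷ u ∷ v ∷ w ∷ [])

InGen3-cong : ∀ {a a′ b b′ c c′} → a ≡ a′ → b ≡ b′ → c ≡ c′ → ∀ x → InGen3 a b c x ⇔ InGen3 a′ b′ c′ x
InGen3-cong refl refl refl x = ⇔.refl

module _ {a b : ℕ} (2a≡3+b : 2 * a ≡ 3 + b) where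

  [s+2q]a≡sa+qb+3q : ∀ s q → (s + 2 * q) * a ≡ s * a + q * b + 3 * q
  [s+2q]a≡sa+qb+3q s q = begin
    (s + 2 * q) * a       ≡⟨ solve (s ∷ q ∷ a ∷ []) ⟩
    s * a + q * (2 * a)   ≡⟨ cong (λ t → s * a + q * t) 2a≡3+b ⟩
    s * a + q * (3 + b)   ≡⟨ solve (s ∷ q ∷ a ∷ b ∷ []) ⟩
    s * a + q * b + 3 * q ∎
    where open ≡-Reasoning

  [s+2q]a∸3q≡sa+qb : ∀ s q → (s + 2 * q) * a ∸ 3 * q ≡ s * a + q * b
  [s+2q]a∸3q≡sa+qb s q = trans (cong (_∸ 3 * q) ([s+2q]a≡sa+qb+3q s q)) (m+n∸n≡m _ (3 * q))

  NormalForm⇔[s+2q]a∸3q+2r : ∀ x →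
    NormalForm a b x ⇔ (∃[ q ] ∃[ r ] ∃[ s ] (r ≤ q × x ≡ (s + 2 * q) * a ∸ 3 * q + 2 * r))
  NormalForm⇔[s+2q]a∸3q+2r x = mk⇔
    (λ (q , r , s , r≤q , x≡) → q , r , s , r≤q , trans x≡ (cong (_+ 2 * r) (sym ([s+2q]a∸3q≡sa+qb s q))))
    (λ (q , r , s , r≤q , x≡) → q , r , s , r≤q , trans x≡ (cong (_+ 2 * r) ([s+2q]a∸3q≡sa+qb s q)))

module Zones {a b : ℕ} (2a≡3+b : 2 * a ≡ 3 + b) where

  -- L j = j a − 3⌊j/2⌋, defined by recursion to avoid truncated subtraction
  L : ℕ → ℕ
  L 0               = 0
  L 1               = a
  L (suc (suc j))   = L j + b

  L+3[j/2]≡ja : ∀ j → L j + 3 * (j / 2) ≡ j * a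
  L+3[j/2]≡ja 0             = refl
  L+3[j/2]≡ja 1             = refl
  L+3[j/2]≡ja (suc (suc j)) = begin
    L j + b + 3 * ((2 + j) / 2)    ≡⟨ cong (λ h → L j + b + 3 * h) ([2+n]/2≡1+n/2 j) ⟩
    L j + b + 3 * suc (j / 2)      ≡⟨ regroup (L j) (j / 2) ⟩
    L j + 3 * (j / 2) + (3 + b)    ≡⟨ cong₂ _+_ (L+3[j/2]≡ja j) (sym 2a≡3+b) ⟩
    j * a + 2 * a                  ≡⟨ solve (j ∷ a ∷ []) ⟩
    (2 + j) * a                    ∎
    where
    open ≡-Reasoning
    regroup : ∀ l h → l + b + 3 * suc h ≡ l + 3 * h + (3 + b)
    regroup l h = solve (l ∷ h ∷ b ∷ [])

  ja∸3[j/2]≡L : ∀ j → j * a ∸ 3 * (j / 2) ≡ L j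
  ja∸3[j/2]≡L j = trans (cong (_∸ 3 * (j / 2)) (sym (L+3[j/2]≡ja j))) (m+n∸n≡m (L j) (3 * (j / 2)))

  L≤ja : ∀ j → L j ≤ j * a
  L≤ja j = subst (L j ≤_) (L+3[j/2]≡ja j) (m≤m+n (L j) _)

  Zone : ℕ → ℕ → Set
  Zone j x = x ≡ L j ⊎ (L j + 2 ≤ x × x ≤ j * a)

  Zone-bounds : ∀ {j x} → Zone j x → L j ≤ x × x ≤ j * a
  Zone-bounds {j} (inj₁ refl)            = ≤-refl , L≤ja j
  Zone-bounds {j} (inj₂ (L+2≤x , x≤ja)) = ≤-trans (m≤m+n (L j) 2) L+2≤x , x≤ja

  1+L∉Zone : ∀ j → ¬ Zone j (suc (L j))
  1+L∉Zone j (inj₁ 1+L≡L)        = 1+n≢n 1+L≡L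
  1+L∉Zone j (inj₂ (L+2≤1+L , _)) = <⇒≱ (subst (suc (L j) <_) (+-comm 2 (L j)) ≤-refl) L+2≤1+L

  L+[3d+2r]∈Zone : ∀ j d r → L j + (3 * d + 2 * r) ≤ j * a → Zone j (L j + (3 * d + 2 * r))
  L+[3d+2r]∈Zone j zero    zero    _   = inj₁ (+-identityʳ (L j))
  L+[3d+2r]∈Zone j zero    (suc r) ≤ja = inj₂ (+-monoʳ-≤ (L j) (*-monoʳ-≤ 2 (s≤s z≤n)) , ≤ja)
  L+[3d+2r]∈Zone j (suc d) r       ≤ja =
    inj₂ (+-monoʳ-≤ (L j) (≤-trans (≤-trans (n≤1+n 2) (*-monoʳ-≤ 3 (s≤s z≤n))) (m≤m+n (3 * suc d) (2 * r)))
         , ≤ja)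

  NormalForm⇒∃Zone : ∀ {x} → NormalForm a b x → ∃[ j ] Zone j x
  NormalForm⇒∃Zone {x} (q , r , s , r≤q , x≡)
    with d , q+d≡h ← m≤n⇒∃[o]m+o≡n (2*m≤n⇒m≤n/2 q (s + 2 * q) (m≤n+m (2 * q) s)) =
    j , subst (Zone j) (sym x≡L+[3d+2r]) (L+[3d+2r]∈Zone j d r (subst (_≤ j * a) x≡L+[3d+2r] x≤ja))
    where
    open ≡-Reasoning
    j = s + 2 * q
    x+3q≡ja+2r : x + 3 * q ≡ j * a + 2 * r
    x+3q≡ja+2r = begin
      x + 3 * q                      ≡⟨ cong (_+ 3 * q) x≡ ⟩
      s * a + q * b + 2 * r + 3 * q  ≡⟨ solve (s ∷ q ∷ r ∷ a ∷ b ∷ []) ⟩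
      s * a + q * b + 3 * q + 2 * r  ≡⟨ cong (_+ 2 * r) ([s+2q]a≡sa+qb+3q 2a≡3+b s q) ⟨
      j * a + 2 * r                  ∎
    regroup : ∀ l q d r → l + 3 * (q + d) + 2 * r ≡ l + (3 * d + 2 * r) + 3 * q
    regroup l q d r = solve (l ∷ q ∷ d ∷ r ∷ [])
    x≡L+[3d+2r] : x ≡ L j + (3 * d + 2 * r)
    x≡L+[3d+2r] = +-cancelʳ-≡ (3 * q) _ _ (begin
      x + 3 * q                       ≡⟨ x+3q≡ja+2r ⟩
      j * a + 2 * r                   ≡⟨ cong (_+ 2 * r) (L+3[j/2]≡ja j) ⟨
      L j + 3 * (j / 2) + 2 * r       ≡⟨ cong (λ h → L j + 3 * h + 2 * r) q+d≡h ⟨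
      L j + 3 * (q + d) + 2 * r       ≡⟨ regroup (L j) q d r ⟩
      L j + (3 * d + 2 * r) + 3 * q   ∎)
    x≤ja : x ≤ j * a
    x≤ja = +-cancelʳ-≤ (3 * q) _ _ (subst (_≤ j * a + 3 * q) (sym x+3q≡ja+2r)
             (+-monoʳ-≤ (j * a) (*-mono-≤ (n≤1+n 2) r≤q)))

  ja≡x+m⇒NormalForm : ∀ {j q r x m} → r ≤ q → 2 * q ≤ j → x + m ≡ j * a → m + 2 * r ≡ 3 * q → NormalForm a b x
  ja≡x+m⇒NormalForm {j} {q} {r} {x} {m} r≤q 2q≤j x+m≡ja m+2r≡3q =
    q , r , s , r≤q , +-cancelʳ-≡ m _ _ (begin
      x + m                          ≡⟨ x+m≡ja ⟩
      j * a                          ≡⟨ cong (_* a) (m∸n+n≡m 2q≤j) ⟨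
      (s + 2 * q) * a                ≡⟨ [s+2q]a≡sa+qb+3q 2a≡3+b s q ⟩
      s * a + q * b + 3 * q          ≡⟨ cong (s * a + q * b +_) m+2r≡3q ⟨
      s * a + q * b + (m + 2 * r)    ≡⟨ cong (s * a + q * b +_) (+-comm m (2 * r)) ⟩
      s * a + q * b + (2 * r + m)    ≡⟨ +-assoc (s * a + q * b) (2 * r) m ⟨
      s * a + q * b + 2 * r + m      ∎)
    where
    open ≡-Reasoning
    s = j ∸ 2 * q

  Zone⇒NormalForm : ∀ {j x} → Zone j x → NormalForm a b x
  Zone⇒NormalForm {j} (inj₁ refl) = ja≡x+m⇒NormalForm {q = j / 2} z≤n (2*[n/2]≤n j) (L+3[j/2]≡ja j) (+-identityʳ _)
  Zone⇒NormalForm {j} {x} (inj₂ (L+2≤x , x≤ja)) =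
    let q , r , r≤q , q≤h , m+2r≡3q = m+2≤3h⇒m+2r≡3q (j * a ∸ x) (j / 2) m+2≤3h
    in  ja≡x+m⇒NormalForm r≤q (≤-trans (*-monoʳ-≤ 2 q≤h) (2*[n/2]≤n j)) (m+[n∸m]≡n x≤ja) m+2r≡3q
    where
    open ≤-Reasoning
    m+2≤3h : j * a ∸ x + 2 ≤ 3 * (j / 2)
    m+2≤3h = +-cancelˡ-≤ (L j) _ _ (begin
      L j + (j * a ∸ x + 2)   ≡⟨ cong (L j +_) (+-comm _ 2) ⟩
      L j + (2 + (j * a ∸ x)) ≡⟨ +-assoc (L j) 2 _ ⟨
      L j + 2 + (j * a ∸ x)   ≤⟨ +-monoˡ-≤ _ L+2≤x ⟩
      x + (j * a ∸ x)         ≡⟨ m+[n∸m]≡n x≤ja ⟩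
      j * a                   ≡⟨ L+3[j/2]≡ja j ⟨
      L j + 3 * (j / 2)       ∎)

  NormalForm⇔∃Zone : ∀ x → NormalForm a b x ⇔ (∃[ j ] Zone j x)
  NormalForm⇔∃Zone x = mk⇔ NormalForm⇒∃Zone (λ (j , x∈Zj) → Zone⇒NormalForm {j} x∈Zj)

3≤2aK : ∀ k → 3 ≤ 2 * aK k
3≤2aK k = ≤-trans (n≤1+n 3) (*-monoʳ-≤ 2 (m≤n+m 2 (3 * k)))

2aK≡3+bK : ∀ k → 2 * aK k ≡ 3 + bK k
2aK≡3+bK k = sym (m+[n∸m]≡n (3≤2aK k))

cK≡bK+2 : ∀ k → cK k ≡ bK k + 2
cK≡bK+2 k = trans (cong (_∸ 1) (2aK≡3+bK k)) (+-comm 2 (bK k))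

bK≡6k+1 : ∀ k → bK k ≡ 6 * k + 1
bK≡6k+1 k = +-cancelˡ-≡ 3 _ _ (begin
  3 + bK k          ≡⟨ 2aK≡3+bK k ⟨
  2 * (3 * k + 2)   ≡⟨ solve (k ∷ []) ⟩
  3 + (6 * k + 1)   ∎)
  where open ≡-Reasoning

InGen3⇔[s+2q]a∸3q+2r : ∀ k x → InGen3 (aK k) (bK k) (cK k) x ⇔
  (∃[ q ] ∃[ r ] ∃[ s ] (r ≤ q × x ≡ (s + 2 * q) * aK k ∸ 3 * q + 2 * r))
InGen3⇔[s+2q]a∸3q+2r k x =
  ⇔.trans (InGen3-cong refl refl (cK≡bK+2 k) x)
    (⇔.trans (InGen3⇔NormalForm (aK k) (bK k) x) (NormalForm⇔[s+2q]a∸3q+2r (2aK≡3+bK k) x))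

module H₉ (k-1 : ℕ) where

  k a b N T : ℕ
  k = suc k-1
  a = aK k
  b = bK k
  N = 2 * k + 1
  T = 2 * k * a + 4

  open Zones {a} {b} (2aK≡3+bK k)

  InI⇔Zone : ∀ j x → InI j k x ⇔ Zone j x
  InI⇔Zone j x = mk⇔ (subst (Interval j x) (ja∸3[j/2]≡L j)) (subst (Interval j x) (sym (ja∸3[j/2]≡L j)))
    where
    Interval : ℕ → ℕ → ℕ → Set
    Interval j x l = x ≡ l ⊎ (l + 2 ≤ x × x ≤ j * a)

  InH9? : Decidable (InH9 k)
  InH9? x = map′ (λ (i , i<N+1 , x∈I) → i , ≤-pred i<N+1 , x∈I) (λ (i , i≤N , x∈I) → i , s≤s i≤N , x∈I)
                     (anyUpTo? (λ i → InI? i) (suc N))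
            ⊎-dec (T ≤? x)
    where
    InI? : ∀ i → Dec (InI i k x)
    InI? i = (x ≟ i * a ∸ 3 * (i / 2)) ⊎-dec ((i * a ∸ 3 * (i / 2) + 2 ≤? x) ×-dec (x ≤? i * a))


  L-step : ∀ j → L j + 2 ≤ L (suc j)
  L-step 0             = m≤n+m 2 (3 * k)
  L-step 1             = begin
    a + 2                          ≤⟨ m≤m+n (a + 2) (3 * k-1) ⟩
    3 * suc k-1 + 2 + 2 + 3 * k-1  ≡⟨ solve (k-1 ∷ []) ⟩
    6 * suc k-1 + 1                ≡⟨ bK≡6k+1 k ⟨
    b                              ∎
    where open ≤-Reasoning
  L-step (suc (suc j)) = subst (_≤ L (suc j) + b) (xy∙z≈xz∙y (L j) 2 b) (+-monoˡ-≤ b (L-step j))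

  L-mono : ∀ {i j} → i ≤ j → L i ≤ L j
  L-mono i≤j = go (≤⇒≤′ i≤j)
    where
    go : ∀ {i j} → i ≤′ j → L i ≤ L j
    go ≤′-refl                  = ≤-refl
    go (≤′-step {j} i≤′j) = ≤-trans (go i≤′j) (≤-trans (m≤m+n (L j) 2) (L-step j))

  N/2≡k : N / 2 ≡ k
  N/2≡k = ≤-antisym (n≤2*m+1⇒n/2≤m k N ≤-refl) (2*m≤n⇒m≤n/2 k N (m≤m+n (2 * k) 1))

  L[N]+2≡T : L N + 2 ≡ T
  L[N]+2≡T = +-cancelʳ-≡ (3 * k) _ _ (begin
    L N + 2 + 3 * k                                  ≡⟨ xy∙z≈xz∙y (L N) 2 (3 * k) ⟩
    L N + 3 * k + 2                                  ≡⟨ cong (λ h → L N + 3 * h + 2) N/2≡k ⟨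
    L N + 3 * (N / 2) + 2                            ≡⟨ cong (_+ 2) (L+3[j/2]≡ja N) ⟩
    (2 * suc k-1 + 1) * (3 * suc k-1 + 2) + 2        ≡⟨ solve (k-1 ∷ []) ⟩
    2 * suc k-1 * (3 * suc k-1 + 2) + 4 + 3 * suc k-1 ∎)
    where open ≡-Reasoning

  T≤Na : T ≤ N * a
  T≤Na = begin
    T                                                     ≤⟨ m≤m+n T (3 * k-1 + 1) ⟩
    2 * suc k-1 * (3 * suc k-1 + 2) + 4 + (3 * k-1 + 1)   ≡⟨ solve (k-1 ∷ []) ⟩
    (2 * suc k-1 + 1) * (3 * suc k-1 + 2)                 ∎
    where open ≤-Reasoning

  1+N≡2[1+k] : suc N ≡ 2 * suc k
  1+N≡2[1+k] = trans (cong suc (+-comm (2 * k) 1)) (sym (*-suc 2 k))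

  T≤L[1+N] : T ≤ L (suc N)
  T≤L[1+N] = +-cancelʳ-≤ (3 * suc k) _ _ (begin
    T + 3 * suc k                                                     ≤⟨ m≤m+n _ (3 * k-1) ⟩
    2 * suc k-1 * (3 * suc k-1 + 2) + 4 + 3 * suc (suc k-1) + 3 * k-1 ≡⟨ solve (k-1 ∷ []) ⟩
    (2 * suc (suc k-1)) * (3 * suc k-1 + 2)                           ≡⟨ cong (_* a) 1+N≡2[1+k] ⟨
    suc N * a                                                         ≡⟨ L+3[j/2]≡ja (suc N) ⟨
    L (suc N) + 3 * (suc N / 2)                                       ≡⟨ cong (λ h → L (suc N) + 3 * (h / 2)) 1+N≡2[1+k] ⟩
    L (suc N) + 3 * (2 * suc k / 2)                                   ≡⟨ cong (λ h → L (suc N) + 3 * h) (2*m/2≡m (suc k)) ⟩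
    L (suc N) + 3 * suc k                                             ∎)
    where open ≤-Reasoning

  L[1+i]≡2+3d+ia : ∀ i → suc i ≤ N → ∃[ d ] (L (suc i) ≡ 2 + 3 * d + i * a)
  L[1+i]≡2+3d+ia i 1+i≤N =
    let d , h+d≡k = m≤n⇒∃[o]m+o≡n (n≤2*m+1⇒n/2≤m k (suc i) 1+i≤N) in
    d , +-cancelʳ-≡ (3 * (suc i / 2)) _ _ (begin
      L (suc i) + 3 * (suc i / 2)            ≡⟨ L+3[j/2]≡ja (suc i) ⟩
      3 * k + 2 + i * a                      ≡⟨ cong (λ m → 3 * m + 2 + i * a) h+d≡k ⟨
      3 * (suc i / 2 + d) + 2 + i * a        ≡⟨ regroup (suc i / 2) d (i * a) ⟩
      2 + 3 * d + i * a + 3 * (suc i / 2)    ∎)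
    where
    open ≡-Reasoning
    regroup : ∀ h d x → 3 * (h + d) + 2 + x ≡ 2 + 3 * d + x + 3 * h
    regroup h d x = solve (h ∷ d ∷ x ∷ [])

  L[1+j]+1+3d≡ja : ∀ j → N ≤ j → ∃[ d ] (L (suc j) + 1 + 3 * d ≡ j * a)
  L[1+j]+1+3d≡ja j N≤j =
    let d , 1+k+d≡h = m≤n⇒∃[o]m+o≡n (2*m≤n⇒m≤n/2 (suc k) (suc j) (subst (_≤ suc j) 1+N≡2[1+k] (s≤s N≤j))) in
    d , +-cancelʳ-≡ a _ _ (begin
      L (suc j) + 1 + 3 * d + (3 * k + 2)    ≡⟨ regroup (L (suc j)) d k ⟩
      L (suc j) + 3 * (suc k + d)            ≡⟨ cong (λ h → L (suc j) + 3 * h) 1+k+d≡h ⟩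
      L (suc j) + 3 * (suc j / 2)            ≡⟨ L+3[j/2]≡ja (suc j) ⟩
      a + j * a                              ≡⟨ +-comm a (j * a) ⟩
      j * a + a                              ∎)
    where
    open ≡-Reasoning
    regroup : ∀ l d m → l + 1 + 3 * d + (3 * m + 2) ≡ l + 3 * (suc m + d)
    regroup l d m = solve (l ∷ d ∷ m ∷ [])

  3+L+3s≡ja : ∀ j → 2 ≤ j → ∃[ s ] (3 + L j + 3 * s ≡ j * a)
  3+L+3s≡ja j 2≤j =
    let s , 1+s≡h = m≤n⇒∃[o]m+o≡n (2*m≤n⇒m≤n/2 1 j 2≤j) in
    s , (begin
      3 + L j + 3 * s          ≡⟨ regroup (L j) s ⟩
      L j + 3 * (1 + s)        ≡⟨ cong (λ h → L j + 3 * h) 1+s≡h ⟩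
      L j + 3 * (j / 2)        ≡⟨ L+3[j/2]≡ja j ⟩
      j * a                    ∎)
    where
    open ≡-Reasoning
    regroup : ∀ l s → 3 + l + 3 * s ≡ l + 3 * (1 + s)
    regroup l s = solve (l ∷ s ∷ [])

  T+n∈Zone : ∀ n → ∃[ j ] (N ≤ j × L j + 2 ≤ T + n × T + n ≤ j * a)
  T+n∈Zone zero    =
    N , ≤-refl , ≤-reflexive (trans L[N]+2≡T (sym (+-identityʳ T))) , subst (_≤ N * a) (sym (+-identityʳ T)) T≤Na
  T+n∈Zone (suc n) =
    let j , N≤j , L+2≤T+n , T+n≤ja = T+n∈Zone n in
    case T + suc n ≤? j * a of λ
      { (yes T+1+n≤ja) → j , N≤j , ≤-trans L+2≤T+n (+-monoʳ-≤ T (n≤1+n n)) , T+1+n≤ja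
      ; (no  T+1+n≰ja) → next-zone j N≤j (≤-antisym T+n≤ja (≤-pred (subst (j * a <_) (+-suc T n) (≰⇒> T+1+n≰ja))))
      }
    where
    next-zone : ∀ j → N ≤ j → T + n ≡ j * a → ∃[ j′ ] (N ≤ j′ × L j′ + 2 ≤ T + suc n × T + suc n ≤ j′ * a)
    next-zone j N≤j T+n≡ja =
      let d , L+1+3d≡ja = L[1+j]+1+3d≡ja j N≤j
          T+1+n≡1+ja = trans (+-suc T n) (cong suc T+n≡ja)
      in suc j , m≤n⇒m≤1+n N≤j
       , subst₂ _≤_ (trans (+-comm 1 (L (suc j) + 1)) (+-assoc (L (suc j)) 1 1)) (sym T+1+n≡1+ja)
           (s≤s (subst (L (suc j) + 1 ≤_) L+1+3d≡ja (m≤m+n _ (3 * d))))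
       , subst (_≤ suc j * a) (sym T+1+n≡1+ja) (+-monoˡ-≤ (j * a) (≤-trans (s≤s z≤n) (m≤n+m 2 (3 * k))))

  InH9⇔∃Zone : ∀ x → InH9 k x ⇔ (∃[ j ] Zone j x)
  InH9⇔∃Zone x = mk⇔ to from
    where
    to : InH9 k x → ∃[ j ] Zone j x
    to (inj₁ (j , _ , x∈I)) = j , Equivalence.to (InI⇔Zone j x) x∈I
    to (inj₂ T≤x) =
      let n , T+n≡x = m≤n⇒∃[o]m+o≡n T≤x
          j , _ , L+2≤T+n , T+n≤ja = T+n∈Zone n
      in j , inj₂ (subst (λ y → L j + 2 ≤ y × y ≤ j * a) T+n≡x (L+2≤T+n , T+n≤ja))
    from : ∃[ j ] Zone j x → InH9 k x
    from (j , x∈Z) = case j ≤? N of λ where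
      (yes j≤N) → inj₁ (j , j≤N , Equivalence.from (InI⇔Zone j x) x∈Z)
      (no  j≰N) → inj₂ (≤-trans T≤L[1+N] (≤-trans (L-mono (≰⇒> j≰N)) (proj₁ (Zone-bounds {j} x∈Z))))

  Zone⇒InH9 : ∀ j {x} → Zone j x → InH9 k x
  Zone⇒InH9 j {x} x∈Z = Equivalence.from (InH9⇔∃Zone x) (j , x∈Z)

  ∉Zones⇒∉H9 : ∀ {x} → (∀ j → ¬ Zone j x) → ¬ InH9 k x
  ∉Zones⇒∉H9 {x} ∉Z x∈H = let j , x∈Z = Equivalence.to (InH9⇔∃Zone x) x∈H in ∉Z j x∈Z

  ∉Zones-between : ∀ i {z} → i * a < z → z < L (suc i) → ∀ j → ¬ Zone j z
  ∉Zones-between i {z} ia<z z<L[1+i] j z∈Z =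
    let L≤z , z≤ja = Zone-bounds {j} z∈Z in
    case j ≤? i of λ where
      (yes j≤i) → <⇒≱ ia<z (≤-trans z≤ja (*-monoˡ-≤ a j≤i))
      (no  j≰i) → <⇒≱ z<L[1+i] (≤-trans (L-mono (≰⇒> j≰i)) L≤z)

  ∉Zones-hole : ∀ i → i * a < L (suc i) → ∀ j → ¬ Zone j (suc (L (suc i)))
  ∉Zones-hole i ia<L j z∈Z =
    let L≤z , z≤ja = Zone-bounds {j} z∈Z in
    case <-cmp j (suc i) of λ where
      (tri< (s≤s j≤i) _ _) → <⇒≱ (≤-trans ia<L (n≤1+n _)) (≤-trans z≤ja (*-monoˡ-≤ a j≤i))
      (tri≈ _ j≡1+i _)     → 1+L∉Zone (suc i) (subst (λ j → Zone j (suc (L (suc i)))) j≡1+i z∈Z)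
      (tri> _ _ 1+i<j)     →
        <⇒≱ (≤-trans (subst (_≤ L (2 + i)) (+-comm (L (suc i)) 2) (L-step (suc i))) (L-mono 1+i<j)) L≤z

  InH9⇔NormalForm : ∀ x → InH9 k x ⇔ NormalForm a b x
  InH9⇔NormalForm x = ⇔.trans (InH9⇔∃Zone x) (⇔.sym (NormalForm⇔∃Zone x))

  InGen3⇔InH9 : ∀ x → InGen3 (aK k) (bK k) (cK k) x ⇔ InH9 k x
  InGen3⇔InH9 x =
    ⇔.trans (InGen3-cong refl refl (cK≡bK+2 k) x)
      (⇔.trans (InGen3⇔NormalForm a b x) (⇔.sym (InH9⇔NormalForm x)))

  ia<L[1+i] : ∀ i → suc i ≤ N → i * a < L (suc i)
  ia<L[1+i] i 1+i≤N =
    let d , L≡ = L[1+i]≡2+3d+ia i 1+i≤N in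
    subst (i * a <_) (sym L≡) (s≤s (≤-trans (m≤n+m (i * a) (3 * d)) (n≤1+n _)))

  open Enumeration InH9? T (λ x → inj₂ (m≤m+n T x))

  next[ia]≡L[1+i] : ∀ i → suc i ≤ N → next (i * a) ≡ L (suc i)
  next[ia]≡L[1+i] i 1+i≤N = next≡ (i * a) (L (suc i)) (ia<L[1+i] i 1+i≤N) (Zone⇒InH9 (suc i) (inj₁ refl))
    λ z ia<z z<L → ∉Zones⇒∉H9 (∉Zones-between i ia<z z<L)

  next[L[1+i]]≡2+L[1+i] : ∀ i → 1 ≤ i → suc i ≤ N → next (L (suc i)) ≡ 2 + L (suc i)
  next[L[1+i]]≡2+L[1+i] i 1≤i 1+i≤N = next≡ (L (suc i)) (2 + L (suc i)) (n≤1+n _) 2+L∈H9 gap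
    where
    2+L∈H9 : InH9 k (2 + L (suc i))
    2+L∈H9 =
      let s , 3+L+3s≡ja = 3+L+3s≡ja (suc i) (s≤s 1≤i) in
      Zone⇒InH9 (suc i) (inj₂ (≤-reflexive (+-comm (L (suc i)) 2) ,
                               subst (2 + L (suc i) ≤_) 3+L+3s≡ja (≤-trans (n≤1+n _) (m≤m+n _ (3 * s)))))
    gap : ∀ z → L (suc i) < z → z < 2 + L (suc i) → ¬ InH9 k z
    gap z L<z z<2+L = subst (λ y → ¬ InH9 k y) (sym (≤-antisym (≤-pred z<2+L) L<z))
                        (∉Zones⇒∉H9 (∉Zones-hole i (ia<L[1+i] i 1+i≤N)))

  data BlockStart : ℕ → Set where
    zone-top   : ∀ {i} → 1 ≤ i → i ≤ N → BlockStart (i * a)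
    zone-inner : ∀ {i x} s → 1 ≤ i → i ≤ N → L i + 2 ≤ x → x + 3 * s ≡ i * a → BlockStart x
    tail       : ∀ {x} → T ≤ x → BlockStart x

  record Block (x : ℕ) : Set where
    field
      y₁ y₂    : ℕ
      next-x   : next x ≡ y₁
      next-y₁  : next y₁ ≡ y₂
      distinct : ResiduesDistinct x y₁ y₂
      start    : BlockStart (next y₂)

  consecutiveBlock : ∀ x → InH9 k (1 + x) → InH9 k (2 + x) → InH9 k (3 + x) → BlockStart (3 + x) → Block x
  consecutiveBlock x 1+x∈H 2+x∈H 3+x∈H start = record
    { y₁       = 1 + x
    ; y₂       = 2 + x
    ; next-x   = next≡suc x 1+x∈H
    ; next-y₁  = next≡suc (1 + x) 2+x∈H
    ; distinct = residuesDistinct x 1 1 (from-no (3 ∣? 1)) (from-no (3 ∣? 1)) (from-no (3 ∣? 2))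
    ; start    = subst BlockStart (sym (next≡suc (2 + x) 3+x∈H)) start
    }

  tailBlock : ∀ {x} → T ≤ x → Block x
  tailBlock {x} T≤x = consecutiveBlock x (tail∋ 1) (tail∋ 2) (tail∋ 3) (tail (≤-trans T≤x (m≤n+m x 3)))
    where
    tail∋ : ∀ c → InH9 k (c + x)
    tail∋ c = inj₂ (≤-trans T≤x (m≤n+m x c))

  topBlock : ∀ {i} → 1 ≤ i → i ≤ N → Block (i * a)
  topBlock {i} 1≤i i≤N = case suc i ≤? N of λ
    { (no  1+i≰N) → tailBlock (subst (λ j → T ≤ j * a) (sym (≤-antisym i≤N (≤-pred (≰⇒> 1+i≰N)))) T≤Na)
    ; (yes 1+i≤N) → nextZoneBlock 1+i≤N
    }
    where
    nextZoneBlock : suc i ≤ N → Block (i * a)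
    nextZoneBlock 1+i≤N =
      let d , L≡ = L[1+i]≡2+3d+ia i 1+i≤N
          s , 3+L+3s≡ja = 3+L+3s≡ja (suc i) (s≤s 1≤i)
          L+2≤3+L = ≤-trans (≤-reflexive (+-comm (L (suc i)) 2)) (n≤1+n _)
          3+L∈Z : Zone (suc i) (3 + L (suc i))
          3+L∈Z = inj₂ (L+2≤3+L , subst (3 + L (suc i) ≤_) 3+L+3s≡ja (m≤m+n _ (3 * s)))
      in record
      { y₁       = L (suc i)
      ; y₂       = 2 + L (suc i)
      ; next-x   = next[ia]≡L[1+i] i 1+i≤N
      ; next-y₁  = next[L[1+i]]≡2+L[1+i] i 1≤i 1+i≤N
      ; distinct = subst (λ y → ResiduesDistinct (i * a) y (2 + y)) (sym L≡)
                     (residuesDistinct (i * a) (2 + 3 * d) 2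
                       (3∤c+3d 2 d (from-no (3 ∣? 2))) (from-no (3 ∣? 2)) (3∤c+3d 4 d (from-no (3 ∣? 4))))
      ; start    = subst BlockStart (sym (next≡suc (2 + L (suc i)) (Zone⇒InH9 (suc i) 3+L∈Z)))
                     (zone-inner s (s≤s z≤n) 1+i≤N L+2≤3+L 3+L+3s≡ja)
      }

  block : ∀ {x} → BlockStart x → Block x
  block (zone-top 1≤i i≤N) = topBlock 1≤i i≤N
  block {x} (zone-inner zero 1≤i i≤N _ x+0≡ia) =
    subst Block (trans (sym x+0≡ia) (+-identityʳ x)) (topBlock 1≤i i≤N)
  block {x} (zone-inner {i} (suc s) 1≤i i≤N L+2≤x x+3[1+s]≡ia) =
    consecutiveBlock x (inner∋ 1 (s≤s z≤n)) (inner∋ 2 (s≤s (s≤s z≤n))) (inner∋ 3 ≤-refl)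
      (zone-inner s 1≤i i≤N (≤-trans L+2≤x (m≤n+m x 3)) 3+x+3s≡ia)
    where
    3+x+3s≡ia : 3 + x + 3 * s ≡ i * a
    3+x+3s≡ia = begin
      3 + x + 3 * s   ≡⟨ solve (x ∷ s ∷ []) ⟩
      x + 3 * suc s   ≡⟨ x+3[1+s]≡ia ⟩
      i * a           ∎
      where open ≡-Reasoning
    inner∋ : ∀ c → c ≤ 3 → InH9 k (c + x)
    inner∋ c c≤3 = Zone⇒InH9 i (inj₂ (≤-trans L+2≤x (m≤n+m x c) ,
                     ≤-trans (+-monoˡ-≤ x c≤3) (subst (3 + x ≤_) 3+x+3s≡ia (m≤m+n (3 + x) (3 * s)))))
  block (tail T≤x) = tailBlock T≤x

  g : ℕ → ℕ
  g = enumerate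

  g1≡a : g 1 ≡ a
  g1≡a = next[ia]≡L[1+i] 0 (s≤s z≤n)

  2≤N : 2 ≤ N
  2≤N = ≤-trans (*-monoʳ-≤ 2 (s≤s z≤n)) (m≤m+n (2 * k) 1)

  g2≡b : g 2 ≡ b
  g2≡b = trans (cong next (trans g1≡a (sym (*-identityˡ a)))) (next[ia]≡L[1+i] 1 2≤N)

  g3≡b+2 : g 3 ≡ b + 2
  g3≡b+2 = trans (cong next g2≡b) (trans (next[L[1+i]]≡2+L[1+i] 1 ≤-refl 2≤N) (+-comm 2 b))

  blockStart : ∀ m → BlockStart (g (m * 3 + 1))
  blockStart zero    = subst BlockStart (trans (*-identityˡ a) (sym g1≡a)) (zone-top ≤-refl (s≤s z≤n))
  blockStart (suc m) = subst (λ y → BlockStart (next y)) (sym (trans (cong next next-x) next-y₁)) start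
    where open Block (block (blockStart m))

  residues : ∀ m (r : Fin 3) → Σ (Fin 3) λ i → (g (m * 3 + suc (toℕ i)) % 3 ≡ toℕ r)
                                             × (∀ j → g (m * 3 + suc (toℕ j)) % 3 ≡ toℕ r → j ≡ i)
  residues m = residues-each-once v (ResiduesDistinct⇒injective v
                 (subst₂ (ResiduesDistinct (v zero)) (sym v₁≡y₁) (sym v₂≡y₂) distinct))
    where
    open Block (block (blockStart m))
    v : Fin 3 → ℕ
    v i = g (m * 3 + suc (toℕ i))
    v₁≡y₁ : v (suc zero) ≡ y₁
    v₁≡y₁ = trans (cong g (+-suc (m * 3) 1)) next-x
    v₂≡y₂ : v (suc (suc zero)) ≡ y₂
    v₂≡y₂ = trans (cong g (trans (+-suc (m * 3) 2) (cong suc (+-suc (m * 3) 1)))) (trans (cong next next-x) next-y₁)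

  generated : ∀ x → InH9 k x ⇔ InGen 3 (λ i → g (suc (toℕ i))) x
  generated x = ⇔.trans (InH9⇔NormalForm x) (⇔.sym
    (⇔.trans (InGen⇔InGen3 (λ i → g (suc (toℕ i))) x)
      (⇔.trans (InGen3-cong g1≡a g2≡b g3≡b+2 x) (InGen3⇔NormalForm a b x))))

  isPermNS : IsPermNS 3 (InH9 k)
  isPermNS = record
    { numSG     = record
      { has0     = 0∈H9
      ; closed+  = λ x y x∈H y∈H → Equivalence.from (InH9⇔NormalForm (x + y))
                     (NormalForm-+ (Equivalence.to (InH9⇔NormalForm x) x∈H) (Equivalence.to (InH9⇔NormalForm y) y∈H))
      ; cofinite = T , λ _ → inj₂
      }
    ; g         = g
    ; enum      = enumerate-isEnumeration 0∈H9
    ; generated = generated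
    ; residues  = residues
    }
    where
    0∈H9 : InH9 k 0
    0∈H9 = Zone⇒InH9 0 (inj₁ refl)

lemma4p9 : (k : ℕ) → 1 ≤ k →
    (∀ x → InGen3 (aK k) (bK k) (cK k) x ⇔ (∃[ q ] ∃[ r ] ∃[ s ] (r ≤ q × x ≡ (s + 2 * q) * aK k ∸ 3 * q + 2 * r)))
    × (∀ x → InGen3 (aK k) (bK k) (cK k) x ⇔ InH9 k x)
    × IsPermNS 3 (InH9 k)
lemma4p9 zero    ()
lemma4p9 (suc k-1) _ = InGen3⇔[s+2q]a∸3q+2r (suc k-1) , InGen3⇔InH9 , isPermNS
  where open H₉ k-1
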